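{- Let $a,b,c,d,e,f$ be independent indeterminates and set $$\varphi(a,b,c,d,e,f)=\sum_{\sigma\in\Sigma_3}\mathrm{sgn}(\sigma)\,(p_{\sigma(1)}p_{\sigma(2)}p_{\sigma(3)}\,d\,e\,f)_{211},\qquad (p_1,p_2,p_3)=(a,b,c).$$ Then $\varphi(a,b,c,d,e,f)\stackrel{\delta}{=}\varphi(a,b,c,d,f,e)\stackrel{\delta}{=}\varphi(a,b,c,f,d,e)$, i.e. $\varphi$ is symmetric in its last three arguments modulo products and lower depth.
   Context: Let $F=\mathbb{Q}(a,\dots,f)$, $V=F^\times\otimes_{\mathbb Z}\mathbb{Q}$ (multiplicative notation inside tensors). The symbol of Goncharov's iterated integral is defined recursively by $\mathcal S(I(a_0;\,;a_1))=1$ and $\mathcal S(I(a_0;a_1,\dots,a_n;a_{n+1}))=\sum_{i=1}^n\mathcal S(I(a_0;\dots,\widehat{a_i},\dots;a_{n+1}))\otimes\frac{a_i-a_{i+1}}{a_i-a_{i-1}}$ (zero factors omitted); $I_{2,1,1}(u_1,u_2,u_3):=I(0;u_1,0,u_2,u_3;1)$. Cross ratio $(pqrs)=\frac{p-r}{p-s}\cdot\frac{q-s}{q-r}$, and $(p_1\cdots p_6)_{211}=I_{2,1,1}((p_1p_2p_3p_4),(p_1p_2p_3p_5),(p_1p_2p_3p_6))$. $X\stackrel{\delta}{=}Y$ means $\mathcal S(X),\mathcal S(Y)$ have the same image under $\pi:V^{\otimes4}\to\bigwedge^2(\bigwedge^2V)$, $a\otimes b\otimes c\otimes d\mapsto(a\wedge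 b)\wedge(c\wedge d)$. -}

module Defs where

open import Level using (0ℓ)
open import Data.Bool using (Bool; true; false; if_then_else_)
open import Data.Fin using (Fin; zero; suc; inject₁)
open import Data.Fin.Properties using () renaming (_≟_ to _≟F_)
open import Data.Nat using (ℕ; zero; suc)
open import Data.List using (List; []; _∷_; [_]; map; concat; _++_)
open import Data.Vec using (Vec; []; _∷_; lookup; removeAt; _∷ʳ_; allFin; toList)
open import Data.Product using (_×_; _,_)
open import Data.Rational using (ℚ; 0ℚ; 1ℚ) renaming (_+_ to _+ℚ_; _*_ to _*ℚ_; -_ to -ℚ_)
open import Data.Rational.Properties using (+-*-commutativeRing)
open import Algebra.Module.Bundles using (Module)
open import Relation.Binary.PropositionalEquality using (_≡_)
open import Relation.Nullary using (¬_; yes; no)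

-- Polynomials in six variables (variable i : Fin 6 stands for a,b,c,d,e,f
-- in that order), given as expressions; two polynomial expressions are the
-- same polynomial iff they agree at every point of ℚ⁶ (ℚ is infinite).

data Pol : Set where
  var  : Fin 6 → Pol
  con  : ℚ → Pol
  _⊕_  : Pol → Pol → Pol
  _⊛_  : Pol → Pol → Pol
  neg  : Pol → Pol

⟦_⟧P : Pol → (Fin 6 → ℚ) → ℚ
⟦ var i ⟧P x = x i
⟦ con q ⟧P x = q
⟦ p ⊕ q ⟧P x = ⟦ p ⟧P x +ℚ ⟦ q ⟧P x
⟦ p ⊛ q ⟧P x = ⟦ p ⟧P x *ℚ ⟦ q ⟧P x
⟦ neg p ⟧P x = -ℚ ⟦ p ⟧P x

_⊝_ : Pol → Pol → Pol
p ⊝ q = p ⊕ neg q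

_≈P_ : Pol → Pol → Set
p ≈P q = ∀ x → ⟦ p ⟧P x ≡ ⟦ q ⟧P x

NonZeroP : Pol → Set
NonZeroP p = ¬ (p ≈P con 0ℚ)

-- Elements of F: fractions num/den (den ≠ 0 is part of NonZeroFrac below).
record Frac : Set where
  constructor _//_
  field
    num : Pol
    den : Pol
open Frac public

_≈F_ : Frac → Frac → Set
(n₁ // d₁) ≈F (n₂ // d₂) = (n₁ ⊛ d₂) ≈P (n₂ ⊛ d₁)

NonZeroFrac : Frac → Set
NonZeroFrac (n // d) = NonZeroP n × NonZeroP d

oneF : Frac
oneF = con 1ℚ // con 1ℚ

zeroF : Frac
zeroF = con 0ℚ // con 1ℚ

_·F_ : Frac → Frac → Frac
(n₁ // d₁) ·F (n₂ // d₂) = (n₁ ⊛ n₂) // (d₁ ⊛ d₂)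

_÷F_ : Frac → Frac → Frac
(n₁ // d₁) ÷F (n₂ // d₂) = (n₁ ⊛ d₂) // (d₁ ⊛ n₂)

_−F_ : Frac → Frac → Frac
(n₁ // d₁) −F (n₂ // d₂) = ((n₁ ⊛ d₂) ⊝ (n₂ ⊛ d₁)) // (d₁ ⊛ d₂)

cr : Pol → Pol → Pol → Pol → Frac
cr p q r s = ((p ⊝ r) ⊛ (q ⊝ s)) // ((p ⊝ s) ⊛ (q ⊝ r))

-- The arguments of I(0; u₁,0,u₂,u₃; 1) are named by labels: z = 0,
-- o = 1, u k = u_{k+1}.  A difference a_i - a_j is a "zero factor" iff the
-- labels coincide (the values 0, 1, u₁, u₂, u₃ used below are pairwise
-- distinct elements of F, so this agrees with the paper's convention).

data Pt : Set where
  z o : Pt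
  u   : Fin 3 → Pt

samePt : Pt → Pt → Bool
samePt z z = true
samePt o o = true
samePt (u i) (u j) with i ≟F j
... | yes _ = true
... | no  _ = false
samePt _ _ = false

factor : (Pt → Frac) → Pt → Pt → Frac
factor val p q = if samePt p q then oneF else (val p −F val q)

-- S(I(a₀; a₁,…,aₙ; aₙ₊₁)) as a list of pure tensors x₁⊗…⊗xₙ (all with
-- coefficient +1), for the argument vector (a₀,…,aₙ₊₁).
symb : (Pt → Frac) → (n : ℕ) → Vec Pt (suc (suc n)) → List (Vec Frac n)
symb val zero    v = [ [] ]
symb val (suc n) v = concat (toList (Data.Vec.map term (allFin (suc n))))
  where
  term : Fin (suc n) → List (Vec Frac (suc n))
  term i = map (_∷ʳ entry) (symb val n (removeAt v (suc (inject₁ i))))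
    where
    ai   = lookup v (suc (inject₁ i))
    prev = lookup v (inject₁ (inject₁ i))
    next = lookup v (suc (suc i))
    entry = factor val ai next ÷F factor val ai prev

data Sgn : Set where
  plus minus : Sgn

Comb : Set
Comb = List (Sgn × Vec Frac 4)

signed : Sgn → List (Vec Frac 4) → Comb
signed s = map (λ t → (s , t))

-- S(I_{2,1,1}(u₁,u₂,u₃)) = S(I(0; u₁,0,u₂,u₃; 1))
S211 : Frac → Frac → Frac → List (Vec Frac 4)
S211 u₁ u₂ u₃ = symb val 4 (z ∷ u zero ∷ z ∷ u (suc zero) ∷ u (suc (suc zero)) ∷ o ∷ [])
  where
  val : Pt → Frac
  val z = zeroF
  val o = oneF
  val (u zero) = u₁
  val (u (suc zero)) = u₂
  val (u (suc (suc _))) = u₃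

S6 : Pol → Pol → Pol → Pol → Pol → Pol → List (Vec Frac 4)
S6 p₁ p₂ p₃ p₄ p₅ p₆ = S211 (cr p₁ p₂ p₃ p₄) (cr p₁ p₂ p₃ p₅) (cr p₁ p₂ p₃ p₆)

Sφ : Pol → Pol → Pol → Pol → Pol → Pol → Comb
Sφ a b c d e f =
     signed plus  (S6 a b c d e f)
  ++ signed plus  (S6 b c a d e f)
  ++ signed plus  (S6 c a b d e f)
  ++ signed minus (S6 b a c d e f)
  ++ signed minus (S6 a c b d e f)
  ++ signed minus (S6 c b a d e f)

-- The map π : V^{⊗4} → ∧²(∧²V), V = F^× ⊗ ℚ, described by its universal
-- property: a ℚ-linear map ∧²(∧²V) → W is the same as a map
-- ω : (F^×)⁴ → W that is a homomorphism (F^×,·) → (W,+) in each slot and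
-- satisfies ω(x,y,z,w) = -ω(y,x,z,w) = -ω(x,y,w,z) = -ω(z,w,x,y).
-- (Slot-1 laws plus the symmetries give the laws in every slot.)

ℚ-ring = +-*-commutativeRing

module _ (W : Module ℚ-ring 0ℓ 0ℓ) where
  open Module W

  record Admissible (ω : Frac → Frac → Frac → Frac → Carrierᴹ) : Set where
    field
      resp  : ∀ {x x′ y z w} → NonZeroFrac x → NonZeroFrac x′ →
              NonZeroFrac y → NonZeroFrac z → NonZeroFrac w →
              x ≈F x′ → ω x y z w ≈ᴹ ω x′ y z w
      mult  : ∀ {x x′ y z w} → NonZeroFrac x → NonZeroFrac x′ →
              NonZeroFrac y → NonZeroFrac z → NonZeroFrac w →
              ω (x ·F x′) y z w ≈ᴹ (ω x y z w +ᴹ ω x′ y z w)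
      anti₁₂ : ∀ {x y z w} → NonZeroFrac x → NonZeroFrac y →
               NonZeroFrac z → NonZeroFrac w →
               ω x y z w ≈ᴹ -ᴹ ω y x z w
      anti₃₄ : ∀ {x y z w} → NonZeroFrac x → NonZeroFrac y →
               NonZeroFrac z → NonZeroFrac w →
               ω x y z w ≈ᴹ -ᴹ ω x y w z
      antiPair : ∀ {x y z w} → NonZeroFrac x → NonZeroFrac y →
                 NonZeroFrac z → NonZeroFrac w →
                 ω x y z w ≈ᴹ -ᴹ ω z w x y

  evalComb : (Frac → Frac → Frac → Frac → Carrierᴹ) → Comb → Carrierᴹ
  evalComb ω [] = 0ᴹ
  evalComb ω ((plus  , (x ∷ y ∷ z′ ∷ w ∷ [])) ∷ r) = ω x y z′ w +ᴹ evalComb ω r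
  evalComb ω ((minus , (x ∷ y ∷ z′ ∷ w ∷ [])) ∷ r) = (-ᴹ ω x y z′ w) +ᴹ evalComb ω r

-- X =δ Y : π(S X) = π(S Y) in ∧²(∧²V)
_≐δ_ : Comb → Comb → Set₁
X ≐δ Y = ∀ (W : Module ℚ-ring 0ℓ 0ℓ) (ω : Frac → Frac → Frac → Frac → Module.Carrierᴹ W) →
         Admissible W ω → Module._≈ᴹ_ W (evalComb W ω X) (evalComb W ω Y)

pa pb pc pd pe pf : Pol
pa = var zero
pb = var (suc zero)
pc = var (suc (suc zero))
pd = var (suc (suc (suc zero)))
pe = var (suc (suc (suc (suc zero))))
pf = var (suc (suc (suc (suc (suc zero)))))

-- Each entry (aᵢ − aᵢ₊₁)/(aᵢ − aᵢ₋₁) of the symbol of (p₁⋯p₆)₂₁₁ is, up to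
-- sign, a Laurent monomial in the differences pᵢ − pⱼ: for cross-ratios
-- u = (p₁p₂p₃pₛ), u′ = (p₁p₂p₃pₜ) each of u − 0, 1 − u and u − u′ factors
-- into such differences.  The map ω : (F^×)⁴ → W through which π factors is
-- multiplicative in each slot, kills ±1 (W is a ℚ-vector space) and is
-- alternating in slots 1,2, in slots 3,4 and under exchange of the two pairs.
-- Expanding every term of φ accordingly writes ω(S φ) as a signed sum of
-- values ω(a, b, c, d) on differences with a < b, c < d and (a, b) < (c, d),
-- with coefficients independent of ω.  For the three orderings of d, e, f
-- these formal sums, once sorted and cancelled, coincide.
module Submission where

open import Level using (0ℓ)
open import Function using (_∘_)
open import Function.Bundles using (Injection)
open import Function.Properties.Inverse using (↔⇒↣)
open import Data.Bool using (true; false)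
open import Data.Empty using (⊥-elim)
open import Data.Nat as ℕ using (ℕ; _+_; _*_; _≤ᵇ_)
import Data.Nat.Properties as ℕ
open import Data.Integer using (+_)
open import Data.Rational using (ℚ; 0ℚ; 1ℚ; ½; _/_) renaming (_+_ to _+ℚ_; _*_ to _*ℚ_; -_ to -ℚ_)
import Data.Rational.Properties as ℚ
open import Data.Rational.Solver using (module +-*-Solver)
open import Data.Fin using (Fin; suc; toℕ; inject₁; _↑ʳ_)
open import Data.Fin.Properties using (all?; ↑ʳ-injective) renaming (_≟_ to _≟ᶠ_; _≤?_ to _≤?ᶠ_)
open import Data.Fin.Patterns using (0F; 1F; 2F; 3F; 4F; 5F)
open import Data.Fin.Permutation using (Permutation′; _⟨$⟩ʳ_; _∘ₚ_; transpose) renaming (id to identity)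
open import Data.List as List using (List; []; _∷_; [_]; _++_; concat; concatMap; foldr)
import Data.List.Properties as List
open import Data.List.Relation.Binary.Permutation.Propositional using (_↭_; ↭⇒↭ₛ′)
open import Data.List.Relation.Binary.Permutation.Propositional.Properties using (map⁺)
import Data.List.Relation.Binary.Permutation.Setoid.Properties as ↭ₛ
import Data.List.Sort.MergeSort as MergeSort
import Data.List.Sort.MergeSort.Properties as MergeSortProperties
open import Data.Product using (_×_; _,_; proj₂)
open import Data.Product.Properties using (≡-dec)
open import Data.Vec as Vec using (Vec; []; _∷_; lookup; tabulate; toList; allFin; removeAt; _∷ʳ_)
import Data.Vec.Properties as Vec
open import Relation.Binary.Bundles using (DecTotalOrder)
open import Relation.Binary.Definitions using (DecidableEquality)
import Relation.Binary.Construct.On as On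
open import Relation.Binary.PropositionalEquality as ≡ using (_≡_; _≢_)
import Relation.Binary.Reasoning.Setoid as SetoidReasoning
open import Relation.Nullary using (yes; no)
open import Relation.Nullary.Decidable using (toWitness; ¬?; _→-dec_)
open import Algebra.Bundles using (AbelianGroup)
import Algebra.Properties.AbelianGroup as AbelianGroupProperties
open import Algebra.Apartness.Properties.HeytingCommutativeRing ℚ.heytingCommutativeRing using (x#0y#0→xy#0)
open import Algebra.Module.Bundles using (Module)

open import Defs

opposite : Sgn → Sgn
opposite plus  = minus
opposite minus = plus

_·ˢ_ : Sgn → Sgn → Sgn
plus  ·ˢ t = t
minus ·ˢ t = opposite t

FormalSum : Set → Set
FormalSum K = List (Sgn × K)

signedMap : {K L : Set} → Sgn → (K → L) → FormalSum K → FormalSum L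
signedMap s f = List.map (λ { (t , k) → (s ·ˢ t , f k) })

withSign : {K : Set} → Sgn → FormalSum K → FormalSum K
withSign s = signedMap s (λ k → k)

_⊖_ : {K : Set} → FormalSum K → FormalSum K → FormalSum K
m ⊖ n = m ++ withSign minus n

_⊗_ : {K L : Set} → FormalSum K → FormalSum L → FormalSum (K × L)
m ⊗ n = concatMap (λ { (s , a) → signedMap s (a ,_) n }) m

lexRank : {K : Set} → ℕ → (K → ℕ) → K × K → ℕ
lexRank bound rank (a , b) = bound * rank a + rank b

-- Sorting by rank makes terms with equal keys adjacent, so cancel removes
-- every cancelling pair; for an injective rank the result is a normal form.
-- Soundness (Σ±-normalise below) holds for every rank.
module Normalisation {K : Set} (_≟_ : DecidableEquality K) (rank : K → ℕ) where

  byRank : DecTotalOrder 0ℓ 0ℓ 0ℓ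
  byRank = On.decTotalOrder ℕ.≤-decTotalOrder (λ (x : Sgn × K) → rank (proj₂ x))

  open MergeSort byRank using (sort) public
  open MergeSortProperties byRank using (sort-↭) public

  push : Sgn × K → FormalSum K → FormalSum K
  push (plus , k) ((minus , l) ∷ m) with k ≟ l
  ... | yes _ = m
  ... | no  _ = (plus , k) ∷ (minus , l) ∷ m
  push (minus , k) ((plus , l) ∷ m) with k ≟ l
  ... | yes _ = m
  ... | no  _ = (minus , k) ∷ (plus , l) ∷ m
  push x m = x ∷ m

  cancel : FormalSum K → FormalSum K
  cancel = foldr push []

  normalise : FormalSum K → FormalSum K
  normalise = cancel ∘ sort

  orientTerm : Sgn × (K × K) → FormalSum (K × K)
  orientTerm (s , (a , b)) with a ≟ b
  ... | yes _ = []
  ... | no  _ with rank a ≤ᵇ rank b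
  ...   | true  = [ (s , (a , b)) ]
  ...   | false = [ (opposite s , (b , a)) ]

  orient : FormalSum (K × K) → FormalSum (K × K)
  orient = concatMap orientTerm

wedge : {K : Set} → DecidableEquality K → (rank : K → ℕ) → (bound : ℕ) →
        FormalSum K → FormalSum K → FormalSum (K × K)
wedge _≟_ rank bound m n =
  Normalisation.normalise (≡-dec _≟_ _≟_) (lexRank bound rank) (Normalisation.orient _≟_ rank (m ⊗ n))

module FormalSumEvaluation {c ℓ} (G : AbelianGroup c ℓ) where

  open AbelianGroup G renaming (Carrier to A)
  open AbelianGroupProperties G
  open SetoidReasoning setoid

  sign : Sgn → A → A
  sign plus  x = x
  sign minus x = x ⁻¹

  Σ± : {K : Set} → (K → A) → FormalSum K → A
  Σ± e []            = ε
  Σ± e ((s , k) ∷ m) = sign s (e k) ∙ Σ± e m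

  sign-cong : ∀ s {x y} → x ≈ y → sign s x ≈ sign s y
  sign-cong plus  x≈y = x≈y
  sign-cong minus x≈y = ⁻¹-cong x≈y

  sign-opposite : ∀ s x → sign (opposite s) x ≈ sign s x ⁻¹
  sign-opposite plus  x = refl
  sign-opposite minus x = sym (⁻¹-involutive x)

  sign-· : ∀ s t x → sign (s ·ˢ t) x ≈ sign s (sign t x)
  sign-· plus  t x = refl
  sign-· minus t x = sign-opposite t x

  sign-∙ : ∀ s x y → sign s (x ∙ y) ≈ sign s x ∙ sign s y
  sign-∙ plus  x y = refl
  sign-∙ minus x y = sym (⁻¹-∙-comm x y)

  sign-⁻¹ : ∀ s x → sign s (x ⁻¹) ≈ sign s x ⁻¹
  sign-⁻¹ plus  x = refl
  sign-⁻¹ minus x = refl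

  sign-ε : ∀ s → sign s ε ≈ ε
  sign-ε plus  = refl
  sign-ε minus = ε⁻¹≈ε

  module _ {K : Set} (e : K → A) where

    Σ±-++ : ∀ m n → Σ± e (m ++ n) ≈ Σ± e m ∙ Σ± e n
    Σ±-++ []            n = sym (identityˡ _)
    Σ±-++ ((s , k) ∷ m) n = begin
      sign s (e k) ∙ Σ± e (m ++ n)      ≈⟨ ∙-congˡ (Σ±-++ m n) ⟩
      sign s (e k) ∙ (Σ± e m ∙ Σ± e n)  ≈⟨ assoc _ _ _ ⟨
      (sign s (e k) ∙ Σ± e m) ∙ Σ± e n  ∎

    Σ±-signedMap : ∀ {L} s (f : L → K) m → Σ± e (signedMap s f m) ≈ sign s (Σ± (e ∘ f) m)
    Σ±-signedMap s f []            = sym (sign-ε s)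
    Σ±-signedMap s f ((t , k) ∷ m) = begin
      sign (s ·ˢ t) (e (f k)) ∙ Σ± e (signedMap s f m)   ≈⟨ ∙-cong (sign-· s t _) (Σ±-signedMap s f m) ⟩
      sign s (sign t (e (f k))) ∙ sign s (Σ± (e ∘ f) m)  ≈⟨ sign-∙ s _ _ ⟨
      sign s (sign t (e (f k)) ∙ Σ± (e ∘ f) m)           ∎

    Σ±-withSign : ∀ s m → Σ± e (withSign s m) ≈ sign s (Σ± e m)
    Σ±-withSign s = Σ±-signedMap s (λ k → k)

    Σ±-⊖ : ∀ m n → Σ± e (m ⊖ n) ≈ Σ± e m ∙ Σ± e n ⁻¹
    Σ±-⊖ m n = trans (Σ±-++ m (withSign minus n)) (∙-congˡ (Σ±-withSign minus n))

    Σ±≡foldr : ∀ m → Σ± e m ≡ foldr _∙_ ε (List.map (λ { (s , k) → sign s (e k) }) m)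
    Σ±≡foldr []            = ≡.refl
    Σ±≡foldr ((s , k) ∷ m) = ≡.cong (sign s (e k) ∙_) (Σ±≡foldr m)

    Σ±-↭ : ∀ {m n} → m ↭ n → Σ± e m ≈ Σ± e n
    Σ±-↭ {m} {n} m↭n = begin
      Σ± e m                                                   ≡⟨ Σ±≡foldr m ⟩
      foldr _∙_ ε (List.map (λ { (s , k) → sign s (e k) }) m)
        ≈⟨ ↭ₛ.foldr-commMonoid setoid isCommutativeMonoid (↭⇒↭ₛ′ isEquivalence (map⁺ _ m↭n)) ⟩
      foldr _∙_ ε (List.map (λ { (s , k) → sign s (e k) }) n)  ≡⟨ Σ±≡foldr n ⟨
      Σ± e n                                                   ∎

  Σ±-⁻¹ : {K : Set} (e : K → A) (m : FormalSum K) → Σ± e m ⁻¹ ≈ Σ± (λ k → e k ⁻¹) m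
  Σ±-⁻¹ e []            = ε⁻¹≈ε
  Σ±-⁻¹ e ((s , k) ∷ m) = begin
    (sign s (e k) ∙ Σ± e m) ⁻¹             ≈⟨ ⁻¹-∙-comm _ _ ⟨
    sign s (e k) ⁻¹ ∙ Σ± e m ⁻¹            ≈⟨ ∙-cong (sym (sign-⁻¹ s (e k))) (Σ±-⁻¹ e m) ⟩
    sign s (e k ⁻¹) ∙ Σ± (λ k → e k ⁻¹) m  ∎

  Σ±-cong : {K : Set} {e e′ : K → A} → (∀ k → e k ≈ e′ k) → ∀ m → Σ± e m ≈ Σ± e′ m
  Σ±-cong e≈e′ []            = refl
  Σ±-cong e≈e′ ((s , k) ∷ m) = ∙-cong (sign-cong s (e≈e′ k)) (Σ±-cong e≈e′ m)

  Σ±-++-cong : {K L : Set} {e : K → A} {e′ : L → A} (m : FormalSum K) (m′ : FormalSum L)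
               {n : FormalSum K} {n′ : FormalSum L} →
               Σ± e m ≈ Σ± e′ m′ → Σ± e n ≈ Σ± e′ n′ → Σ± e (m ++ n) ≈ Σ± e′ (m′ ++ n′)
  Σ±-++-cong {e = e} {e′} m m′ {n} {n′} m≈m′ n≈n′ = begin
    Σ± e (m ++ n)        ≈⟨ Σ±-++ e m n ⟩
    Σ± e m ∙ Σ± e n      ≈⟨ ∙-cong m≈m′ n≈n′ ⟩
    Σ± e′ m′ ∙ Σ± e′ n′  ≈⟨ Σ±-++ e′ m′ n′ ⟨
    Σ± e′ (m′ ++ n′)     ∎

  Σ±-⊗ : {K L : Set} (e : K × L → A) (m : FormalSum K) (n : FormalSum L) →
         Σ± e (m ⊗ n) ≈ Σ± (λ a → Σ± (λ b → e (a , b)) n) m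
  Σ±-⊗ e []            n = refl
  Σ±-⊗ e ((s , a) ∷ m) n = begin
    Σ± e (signedMap s (a ,_) n ++ m ⊗ n)        ≈⟨ Σ±-++ e (signedMap s (a ,_) n) (m ⊗ n) ⟩
    Σ± e (signedMap s (a ,_) n) ∙ Σ± e (m ⊗ n)  ≈⟨ ∙-cong (Σ±-signedMap e s (a ,_) n) (Σ±-⊗ e m n) ⟩
    sign s (Σ± (λ b → e (a , b)) n) ∙ Σ± (λ a → Σ± (λ b → e (a , b)) n) m ∎

  module _ {K : Set} (_≟_ : DecidableEquality K) (rank : K → ℕ) (e : K → A) where

    open Normalisation _≟_ rank

    Σ±-push : ∀ x m → Σ± e (push x m) ≈ Σ± e (x ∷ m)
    Σ±-push (plus , k) ((minus , l) ∷ m) with k ≟ l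
    ... | yes ≡.refl = sym (\\-leftDividesˡ (e k) (Σ± e m))
    ... | no  _      = refl
    Σ±-push (minus , k) ((plus , l) ∷ m) with k ≟ l
    ... | yes ≡.refl = sym (\\-leftDividesʳ (e k) (Σ± e m))
    ... | no  _      = refl
    Σ±-push (plus  , k) []                = refl
    Σ±-push (plus  , k) ((plus  , l) ∷ m) = refl
    Σ±-push (minus , k) []                = refl
    Σ±-push (minus , k) ((minus , l) ∷ m) = refl

    Σ±-cancel : ∀ m → Σ± e (cancel m) ≈ Σ± e m
    Σ±-cancel []      = refl
    Σ±-cancel (x ∷ m) = trans (Σ±-push x (cancel m)) (∙-congˡ (Σ±-cancel m))

    Σ±-normalise : ∀ m → Σ± e (normalise m) ≈ Σ± e m
    Σ±-normalise m = trans (Σ±-cancel (sort m)) (Σ±-↭ e (sort-↭ m))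

  module _ {K : Set} (_≟_ : DecidableEquality K) (rank : K → ℕ)
           (e : K × K → A) (e-diagonal : ∀ a → e (a , a) ≈ ε)
           (e-antisymmetric : ∀ a b → e (a , b) ≈ e (b , a) ⁻¹) where

    open Normalisation _≟_ rank using (orientTerm; orient)

    Σ±-orientTerm : ∀ x → Σ± e (orientTerm x) ≈ Σ± e [ x ]
    Σ±-orientTerm (s , (a , b)) with a ≟ b
    ... | yes ≡.refl = begin
      ε                       ≈⟨ sign-ε s ⟨
      sign s ε                ≈⟨ sign-cong s (e-diagonal a) ⟨
      sign s (e (a , a))      ≈⟨ identityʳ _ ⟨
      sign s (e (a , a)) ∙ ε  ∎
    ... | no _ with rank a ≤ᵇ rank b
    ...   | true  = refl
    ...   | false = ∙-congʳ (begin
      sign (opposite s) (e (b , a))  ≈⟨ sign-opposite s _ ⟩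
      sign s (e (b , a)) ⁻¹          ≈⟨ sign-⁻¹ s _ ⟨
      sign s (e (b , a) ⁻¹)          ≈⟨ sign-cong s (e-antisymmetric a b) ⟨
      sign s (e (a , b))             ∎)

    Σ±-orient : ∀ m → Σ± e (orient m) ≈ Σ± e m
    Σ±-orient []      = refl
    Σ±-orient (x ∷ m) = begin
      Σ± e (orientTerm x ++ orient m)        ≈⟨ Σ±-++ e (orientTerm x) (orient m) ⟩
      Σ± e (orientTerm x) ∙ Σ± e (orient m)  ≈⟨ ∙-cong (Σ±-orientTerm x) (Σ±-orient m) ⟩
      Σ± e [ x ] ∙ Σ± e m                    ≈⟨ Σ±-++ e [ x ] m ⟨
      Σ± e (x ∷ m)                           ∎

    Σ±-wedge : ∀ bound m n → Σ± e (wedge _≟_ rank bound m n) ≈ Σ± (λ a → Σ± (λ b → e (a , b)) n) m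
    Σ±-wedge bound m n = begin
      Σ± e (wedge _≟_ rank bound m n)
        ≈⟨ Σ±-normalise (≡-dec _≟_ _≟_) (lexRank bound rank) e (orient (m ⊗ n)) ⟩
      Σ± e (orient (m ⊗ n))                ≈⟨ Σ±-orient (m ⊗ n) ⟩
      Σ± e (m ⊗ n)                         ≈⟨ Σ±-⊗ e m n ⟩
      Σ± (λ a → Σ± (λ b → e (a , b)) n) m  ∎

module _ {ℓ ℓ′} (M : Module ℚ-ring ℓ ℓ′) where

  open Module M
  open SetoidReasoning ≈ᴹ-setoid

  x+x≈0⇒x≈0 : ∀ {x} → x +ᴹ x ≈ᴹ 0ᴹ → x ≈ᴹ 0ᴹ
  x+x≈0⇒x≈0 {x} x+x≈0 = begin
    x                 ≈⟨ *ₗ-identityˡ x ⟨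
    (½ +ℚ ½) *ₗ x     ≈⟨ *ₗ-distribʳ x ½ ½ ⟩
    ½ *ₗ x +ᴹ ½ *ₗ x  ≈⟨ *ₗ-distribˡ ½ x x ⟨
    ½ *ₗ (x +ᴹ x)     ≈⟨ *ₗ-congˡ x+x≈0 ⟩
    ½ *ₗ 0ᴹ           ≈⟨ *ₗ-zeroʳ ½ ⟩
    0ᴹ                ∎

  x≈-x⇒x≈0 : ∀ {x} → x ≈ᴹ -ᴹ x → x ≈ᴹ 0ᴹ
  x≈-x⇒x≈0 {x} x≈-x = x+x≈0⇒x≈0 (≈ᴹ-trans (+ᴹ-congˡ x≈-x) (-ᴹ‿inverseʳ x))

substP : (Fin 6 → Pol) → Pol → Pol
substP σ (var i) = σ i
substP σ (con q) = con q
substP σ (p ⊕ q) = substP σ p ⊕ substP σ q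
substP σ (p ⊛ q) = substP σ p ⊛ substP σ q
substP σ (neg p) = neg (substP σ p)

⟦substP⟧ : ∀ σ p x → ⟦ substP σ p ⟧P x ≡ ⟦ p ⟧P (λ i → ⟦ σ i ⟧P x)
⟦substP⟧ σ (var i) x = ≡.refl
⟦substP⟧ σ (con q) x = ≡.refl
⟦substP⟧ σ (p ⊕ q) x = ≡.cong₂ _+ℚ_ (⟦substP⟧ σ p x) (⟦substP⟧ σ q x)
⟦substP⟧ σ (p ⊛ q) x = ≡.cong₂ _*ℚ_ (⟦substP⟧ σ p x) (⟦substP⟧ σ q x)
⟦substP⟧ σ (neg p) x = ≡.cong -ℚ_ (⟦substP⟧ σ p x)

substF : (Fin 6 → Pol) → Frac → Frac
substF σ (n // d) = substP σ n // substP σ d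

≈F-subst : ∀ σ {x y} → x ≈F y → substF σ x ≈F substF σ y
≈F-subst σ {n₁ // d₁} {n₂ // d₂} x≈y v = begin
  ⟦ substP σ (n₁ ⊛ d₂) ⟧P v        ≡⟨ ⟦substP⟧ σ (n₁ ⊛ d₂) v ⟩
  ⟦ n₁ ⊛ d₂ ⟧P (λ i → ⟦ σ i ⟧P v)  ≡⟨ x≈y _ ⟩
  ⟦ n₂ ⊛ d₁ ⟧P (λ i → ⟦ σ i ⟧P v)  ≡⟨ ⟦substP⟧ σ (n₂ ⊛ d₁) v ⟨
  ⟦ substP σ (n₂ ⊛ d₁) ⟧P v        ∎
  where open ≡.≡-Reasoning

open +-*-Solver using (Polynomial; prove; _:+_; _:*_; :-_)
  renaming (⟦_⟧ to ⟦_⟧S; ⟦_⟧↓ to ⟦_⟧↓S; var to svar; con to scon)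

toPolynomial : Pol → Polynomial 6
toPolynomial (var i) = svar i
toPolynomial (con q) = scon q
toPolynomial (p ⊕ q) = toPolynomial p :+ toPolynomial q
toPolynomial (p ⊛ q) = toPolynomial p :* toPolynomial q
toPolynomial (neg p) = :- toPolynomial p

⟦toPolynomial⟧ : ∀ p x → ⟦ toPolynomial p ⟧S (tabulate x) ≡ ⟦ p ⟧P x
⟦toPolynomial⟧ (var i) x = Vec.lookup∘tabulate x i
⟦toPolynomial⟧ (con q) x = ≡.refl
⟦toPolynomial⟧ (p ⊕ q) x = ≡.cong₂ _+ℚ_ (⟦toPolynomial⟧ p x) (⟦toPolynomial⟧ q x)
⟦toPolynomial⟧ (p ⊛ q) x = ≡.cong₂ _*ℚ_ (⟦toPolynomial⟧ p x) (⟦toPolynomial⟧ q x)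
⟦toPolynomial⟧ (neg p) x = ≡.cong -ℚ_ (⟦toPolynomial⟧ p x)

≈P-byRing : ∀ {p q} → (∀ ρ → ⟦ toPolynomial p ⟧↓S ρ ≡ ⟦ toPolynomial q ⟧↓S ρ) → p ≈P q
≈P-byRing {p} {q} same-normal-form x = begin
  ⟦ p ⟧P x                          ≡⟨ ⟦toPolynomial⟧ p x ⟨
  ⟦ toPolynomial p ⟧S (tabulate x)  ≡⟨ prove (tabulate x) (toPolynomial p) (toPolynomial q) (same-normal-form _) ⟩
  ⟦ toPolynomial q ⟧S (tabulate x)  ≡⟨ ⟦toPolynomial⟧ q x ⟩
  ⟦ q ⟧P x                          ∎
  where open ≡.≡-Reasoning

-- Identities of rational functions are checked by the ring solver in the
-- placeholders x₀ … x₄ and then instantiated by a substitution.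
≈F-byRing : ∀ σ x y →
            (∀ ρ → ⟦ toPolynomial (num x ⊛ den y) ⟧↓S ρ ≡ ⟦ toPolynomial (num y ⊛ den x) ⟧↓S ρ) →
            substF σ x ≈F substF σ y
≈F-byRing σ x@(n₁ // d₁) y@(n₂ // d₂) same-normal-form =
  ≈F-subst σ {x} {y} (≈P-byRing {n₁ ⊛ d₂} {n₂ ⊛ d₁} same-normal-form)

x₀ x₁ x₂ x₃ x₄ : Pol
x₀ = var 0F
x₁ = var 1F
x₂ = var 2F
x₃ = var 3F
x₄ = var 4F

substitution : Pol → Pol → Pol → Pol → Pol → Fin 6 → Pol
substitution p q r s t = lookup (p ∷ q ∷ r ∷ s ∷ t ∷ t ∷ [])

diff : Pol → Pol → Frac
diff p q = (p ⊝ q) // con 1ℚ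

negOne : Frac
negOne = neg (con 1ℚ) // con 1ℚ

-- Nonvanishing at one rational point certifies that a polynomial is nonzero;
-- unlike NonZeroP, this certificate is closed under products.

sample : Fin 6 → ℚ
sample i = + toℕ i / 1

record NonVanishing (p : Pol) : Set where
  constructor nonVanishing
  field sample≢0 : ⟦ p ⟧P sample ≢ 0ℚ

record NonVanishingF (x : Frac) : Set where
  constructor _//≢0_
  field
    num≢0 : NonVanishing (num x)
    den≢0 : NonVanishing (den x)

open NonVanishing
open NonVanishingF

nonVanishing⇒nonZeroFrac : ∀ {x} → NonVanishingF x → NonZeroFrac x
nonVanishing⇒nonZeroFrac (nonVanishing n≢0 //≢0 nonVanishing d≢0) =
  (λ n≈0 → n≢0 (n≈0 sample)) , (λ d≈0 → d≢0 (d≈0 sample))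

nonVanishing-⊛ : ∀ {p q} → NonVanishing p → NonVanishing q → NonVanishing (p ⊛ q)
nonVanishing-⊛ (nonVanishing p≢0) (nonVanishing q≢0) = nonVanishing (x#0y#0→xy#0 p≢0 q≢0)

nonVanishing-⊛-comm : ∀ {p q} → NonVanishing (p ⊛ q) → NonVanishing (q ⊛ p)
nonVanishing-⊛-comm {p} (nonVanishing pq≢0) =
  nonVanishing λ qp≡0 → pq≢0 (≡.trans (ℚ.*-comm (⟦ p ⟧P sample) _) qp≡0)

nonVanishing-one : NonVanishing (con 1ℚ)
nonVanishing-one = nonVanishing λ ()

nonVanishing-difference : ∀ {i j} → i ≢ j → NonVanishing (var i ⊝ var j)
nonVanishing-difference {i} {j} i≢j = nonVanishing (differences≢0 i j i≢j)
  where
  differences≢0 : ∀ i j → i ≢ j → ⟦ var i ⊝ var j ⟧P sample ≢ 0ℚ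
  differences≢0 = toWitness {a? = all? λ i → all? λ j → ¬? (i ≟ᶠ j) →-dec ¬? (⟦ var i ⊝ var j ⟧P sample ℚ.≟ 0ℚ)} _

nonVanishing-≈F : ∀ {x y} → x ≈F y → NonVanishingF y → NonVanishing (den x) → NonVanishingF x
nonVanishing-≈F {n₁ // d₁} {n₂ // d₂} x≈y (n₂≢0 //≢0 _) d₁≢0 = nonVanishing n₁≢0 //≢0 d₁≢0
  where
  n₁≢0 : ⟦ n₁ ⟧P sample ≢ 0ℚ
  n₁≢0 n₁≡0 = sample≢0 (nonVanishing-⊛ n₂≢0 d₁≢0) (begin
    ⟦ n₂ ⟧P sample *ℚ ⟦ d₁ ⟧P sample  ≡⟨ x≈y sample ⟨
    ⟦ n₁ ⟧P sample *ℚ ⟦ d₂ ⟧P sample  ≡⟨ ≡.cong (_*ℚ ⟦ d₂ ⟧P sample) n₁≡0 ⟩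
    0ℚ *ℚ ⟦ d₂ ⟧P sample              ≡⟨ ℚ.*-zeroˡ (⟦ d₂ ⟧P sample) ⟩
    0ℚ                                ∎)
    where open ≡.≡-Reasoning

nonVanishing-·F : ∀ {x y} → NonVanishingF x → NonVanishingF y → NonVanishingF (x ·F y)
nonVanishing-·F {_ // _} {_ // _} (n₁≢0 //≢0 d₁≢0) (n₂≢0 //≢0 d₂≢0) =
  nonVanishing-⊛ n₁≢0 n₂≢0 //≢0 nonVanishing-⊛ d₁≢0 d₂≢0

nonVanishing-÷F : ∀ {x y} → NonVanishingF x → NonVanishingF y → NonVanishingF (x ÷F y)
nonVanishing-÷F {_ // _} {_ // _} (n₁≢0 //≢0 d₁≢0) (n₂≢0 //≢0 d₂≢0) =
  nonVanishing-⊛ n₁≢0 d₂≢0 //≢0 nonVanishing-⊛ d₁≢0 n₂≢0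

nonVanishing-oneF : NonVanishingF oneF
nonVanishing-oneF = nonVanishing-one //≢0 nonVanishing-one

Atom : Set
Atom = Fin 6 × Fin 6

-- Diagonal pairs never occur in an expansion; sending them to 1 keeps
-- every atom nonzero, as the laws of ω require.
atom : Atom → Frac
atom (i , j) with i ≟ᶠ j
... | yes _ = oneF
... | no  _ = diff (var i) (var j)

atom≡diff : ∀ {i j} → i ≢ j → atom (i , j) ≡ diff (var i) (var j)
atom≡diff {i} {j} i≢j with i ≟ᶠ j
... | yes i≡j = ⊥-elim (i≢j i≡j)
... | no  _   = ≡.refl

nonVanishing-atom : ∀ a → NonVanishingF (atom a)
nonVanishing-atom (i , j) with i ≟ᶠ j
... | yes _   = nonVanishing-oneF
... | no  i≢j = nonVanishing-difference i≢j //≢0 nonVanishing-one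

atomOf : Fin 6 → Fin 6 → Atom
atomOf i j with i ≤?ᶠ j
... | yes _ = (i , j)
... | no  _ = (j , i)

Pair Quad : Set
Pair = Atom × Atom
Quad = Pair × Pair

_≟ᵃ_ : DecidableEquality Atom
_≟ᵃ_ = ≡-dec _≟ᶠ_ _≟ᶠ_

_≟ᵖ_ : DecidableEquality Pair
_≟ᵖ_ = ≡-dec _≟ᵃ_ _≟ᵃ_

-- The bounds 6, 36 and 1296 exceed the ranks below them, so every rank is injective.
atomRank : Atom → ℕ
atomRank = lexRank 6 toℕ

pairRank : Pair → ℕ
pairRank = lexRank 36 atomRank

_∧ᵃ_ : FormalSum Atom → FormalSum Atom → FormalSum Pair
_∧ᵃ_ = wedge _≟ᵃ_ atomRank 36

_∧ᵖ_ : FormalSum Pair → FormalSum Pair → FormalSum Quad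
_∧ᵖ_ = wedge _≟ᵖ_ pairRank 1296

normaliseAtoms : FormalSum Atom → FormalSum Atom
normaliseAtoms = Normalisation.normalise _≟ᵃ_ atomRank

normaliseQuads : FormalSum Quad → FormalSum Quad
normaliseQuads = Normalisation.normalise (≡-dec _≟ᵖ_ _≟ᵖ_) (lexRank 1296 pairRank)

-- (aᵢ , aᵢ₊₁ , aᵢ₋₁): the labels of the symbol entry (aᵢ − aᵢ₊₁)/(aᵢ − aᵢ₋₁).
Labels : Set
Labels = Pt × Pt × Pt

skeleton : (n : ℕ) → Vec Pt (ℕ.suc (ℕ.suc n)) → List (Vec Labels n)
skeleton ℕ.zero    v = [ [] ]
skeleton (ℕ.suc n) v = concat (toList (Vec.map term (allFin (ℕ.suc n))))
  where
  term : Fin (ℕ.suc n) → List (Vec Labels (ℕ.suc n))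
  term i = List.map (_∷ʳ (lookup v (suc (inject₁ i)) , lookup v (suc (suc i)) , lookup v (inject₁ (inject₁ i))))
                    (skeleton n (removeAt v (suc (inject₁ i))))

entryAt : (Pt → Frac) → Labels → Frac
entryAt val (a , next , prev) = factor val a next ÷F factor val a prev

symb≡skeleton : ∀ val n v → symb val n v ≡ List.map (Vec.map (entryAt val)) (skeleton n v)
symb≡skeleton val ℕ.zero    v = ≡.refl
symb≡skeleton val (ℕ.suc n) v = begin
  concat (toList (Vec.map (λ i → List.map (_∷ʳ entryAt val (labels i)) (symb val n (rest i))) indices))
    ≡⟨ ≡.cong (concat ∘ toList) (Vec.map-cong term≡ indices) ⟩
  concat (toList (Vec.map (List.map F ∘ term) indices))
    ≡⟨ ≡.cong (concat ∘ toList) (Vec.map-∘ (List.map F) term indices) ⟩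
  concat (toList (Vec.map (List.map F) (Vec.map term indices)))
    ≡⟨ ≡.cong concat (Vec.toList-map (List.map F) (Vec.map term indices)) ⟩
  concat (List.map (List.map F) (toList (Vec.map term indices)))
    ≡⟨ List.concat-map (toList (Vec.map term indices)) ⟩
  List.map F (concat (toList (Vec.map term indices)))
    ∎
  where
  open ≡.≡-Reasoning
  indices : Vec (Fin (ℕ.suc n)) (ℕ.suc n)
  indices = allFin (ℕ.suc n)
  F : ∀ {m} → Vec Labels m → Vec Frac m
  F = Vec.map (entryAt val)
  labels : Fin (ℕ.suc n) → Labels
  labels i = lookup v (suc (inject₁ i)) , lookup v (suc (suc i)) , lookup v (inject₁ (inject₁ i))
  rest : Fin (ℕ.suc n) → Vec Pt (ℕ.suc (ℕ.suc n))
  rest i = removeAt v (suc (inject₁ i))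
  term : Fin (ℕ.suc n) → List (Vec Labels (ℕ.suc n))
  term i = List.map (_∷ʳ labels i) (skeleton n (rest i))
  term≡ : ∀ i → List.map (_∷ʳ entryAt val (labels i)) (symb val n (rest i)) ≡ List.map F (term i)
  term≡ i = begin
    List.map (_∷ʳ entryAt val (labels i)) (symb val n (rest i))
      ≡⟨ ≡.cong (List.map (_∷ʳ entryAt val (labels i))) (symb≡skeleton val n (rest i)) ⟩
    List.map (_∷ʳ entryAt val (labels i)) (List.map F (skeleton n (rest i)))
      ≡⟨ List.map-∘ (skeleton n (rest i)) ⟨
    List.map ((_∷ʳ entryAt val (labels i)) ∘ F) (skeleton n (rest i))
      ≡⟨ List.map-cong (Vec.map-∷ʳ (entryAt val) (labels i)) (skeleton n (rest i)) ⟨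
    List.map (F ∘ (_∷ʳ labels i)) (skeleton n (rest i))
      ≡⟨ List.map-∘ (skeleton n (rest i)) ⟩
    List.map F (term i)
      ∎

i211Points : Vec Pt 6
i211Points = z ∷ u 0F ∷ z ∷ u 1F ∷ u 2F ∷ o ∷ []

Configuration : Set
Configuration = Permutation′ 6

point : Configuration → Fin 6 → Pol
point π i = var (π ⟨$⟩ʳ i)

uPoint : Fin 3 → Fin 6
uPoint k = 3 ↑ʳ k

labelValue : Configuration → Pt → Frac
labelValue π z     = zeroF
labelValue π o     = oneF
labelValue π (u k) = cr (point π 0F) (point π 1F) (point π 2F) (point π (uPoint k))

S6At : Configuration → List (Vec Frac 4)
S6At π = S6 (point π 0F) (point π 1F) (point π 2F) (point π 3F) (point π 4F) (point π 5F)

S6≡skeleton : ∀ π → S6At π ≡ List.map (Vec.map (entryAt (labelValue π))) (skeleton 4 i211Points)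
S6≡skeleton π = symb≡skeleton (labelValue π) 4 i211Points

φAt : Configuration → Comb
φAt π = Sφ (point π 0F) (point π 1F) (point π 2F) (point π 3F) (point π 4F) (point π 5F)

difference : Configuration → Fin 6 → Fin 6 → FormalSum Atom
difference π i j = [ (plus , atomOf (π ⟨$⟩ʳ i) (π ⟨$⟩ʳ j)) ]

crAtoms : Configuration → Fin 3 → FormalSum Atom
crAtoms π k = (difference π 0F 2F ++ difference π 1F (uPoint k))
            ⊖ (difference π 0F (uPoint k) ++ difference π 1F 2F)

oneMinusCrAtoms : Configuration → Fin 3 → FormalSum Atom
oneMinusCrAtoms π k = (difference π 0F 1F ++ difference π (uPoint k) 2F)
                    ⊖ (difference π 0F (uPoint k) ++ difference π 1F 2F)

crDifferenceAtoms : Configuration → Fin 3 → Fin 3 → FormalSum Atom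
crDifferenceAtoms π k l = ((difference π 0F 2F ++ difference π 0F 1F) ++ difference π (uPoint l) (uPoint k))
                        ⊖ ((difference π 1F 2F ++ difference π 0F (uPoint k)) ++ difference π 0F (uPoint l))

factorAtoms : Configuration → Pt → Pt → FormalSum Atom
factorAtoms π (u k) z = crAtoms π k
factorAtoms π z (u k) = crAtoms π k
factorAtoms π (u k) o = oneMinusCrAtoms π k
factorAtoms π o (u k) = oneMinusCrAtoms π k
factorAtoms π (u k) (u l) with k ≟ᶠ l
... | yes _ = []
... | no  _ = crDifferenceAtoms π k l
factorAtoms π _ _ = []

entryAtoms : Configuration → Labels → FormalSum Atom
entryAtoms π (a , next , prev) = normaliseAtoms (factorAtoms π a next ⊖ factorAtoms π a prev)

tensorQuads : Configuration → Vec Labels 4 → FormalSum Quad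
tensorQuads π (t₁ ∷ t₂ ∷ t₃ ∷ t₄ ∷ []) =
  (entryAtoms π t₁ ∧ᵃ entryAtoms π t₂) ∧ᵖ (entryAtoms π t₃ ∧ᵃ entryAtoms π t₄)

i211Quads : Configuration → FormalSum Quad
i211Quads π = concatMap (tensorQuads π) (skeleton 4 i211Points)

-- _∘ₚ_ composes diagrammatically, point (σ ∘ₚ π) i = point π (σ ⟨$⟩ʳ i):
-- cycle lists p₂ p₃ p₁ and cycle² lists p₃ p₁ p₂, as in Sφ.
cycle cycle² : Configuration
cycle  = transpose 0F 1F ∘ₚ transpose 0F 2F
cycle² = transpose 0F 2F ∘ₚ transpose 0F 1F

antisymmetrise : {B : Set} → (Sgn → Configuration → List B) → Configuration → List B
antisymmetrise f π = f plus  π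
                  ++ f plus  (cycle ∘ₚ π)
                  ++ f plus  (cycle² ∘ₚ π)
                  ++ f minus (transpose 0F 1F ∘ₚ π)
                  ++ f minus (transpose 1F 2F ∘ₚ π)
                  ++ f minus (transpose 0F 2F ∘ₚ π)

φQuads : Configuration → FormalSum Quad
φQuads = antisymmetrise λ s π → withSign s (i211Quads π)

module _ (W : Module ℚ-ring 0ℓ 0ℓ) (ω : Frac → Frac → Frac → Frac → Module.Carrierᴹ W)
         (adm : Admissible W ω) where

  open Module W
  open Admissible adm
  open FormalSumEvaluation +ᴹ-abelianGroup
  open AbelianGroupProperties +ᴹ-abelianGroup using (identityˡ-unique; x≈z//y)
  open SetoidReasoning ≈ᴹ-setoid

  nonZero-atom : ∀ a → NonZeroFrac (atom a)
  nonZero-atom a = nonVanishing⇒nonZeroFrac (nonVanishing-atom a)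

  ωVec : Vec Frac 4 → Carrierᴹ
  ωVec (x ∷ y ∷ z′ ∷ w ∷ []) = ω x y z′ w

  ωQuad : Quad → Carrierᴹ
  ωQuad ((a , b) , (c , d)) = ω (atom a) (atom b) (atom c) (atom d)

  module _ {y₁ y₂ y₃ : Frac} (y₁≠0 : NonZeroFrac y₁) (y₂≠0 : NonZeroFrac y₂) (y₃≠0 : NonZeroFrac y₃) where

    private
      one≠0 : NonZeroFrac oneF
      one≠0 = nonVanishing⇒nonZeroFrac nonVanishing-oneF

    ω-oneF : ω oneF y₁ y₂ y₃ ≈ᴹ 0ᴹ
    ω-oneF = identityˡ-unique _ _ (begin
      ω oneF y₁ y₂ y₃ +ᴹ ω oneF y₁ y₂ y₃  ≈⟨ mult one≠0 one≠0 y₁≠0 y₂≠0 y₃≠0 ⟨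
      ω (oneF ·F oneF) y₁ y₂ y₃           ≈⟨ resp one≠0 one≠0 y₁≠0 y₂≠0 y₃≠0 (λ _ → ≡.refl) ⟩
      ω oneF y₁ y₂ y₃                     ∎)

    ω-unit : ∀ {x} → NonVanishingF x → (x ·F x) ≈F oneF → ω x y₁ y₂ y₃ ≈ᴹ 0ᴹ
    ω-unit {x} x≠0 x²≈1 = x+x≈0⇒x≈0 W (begin
      ω x y₁ y₂ y₃ +ᴹ ω x y₁ y₂ y₃  ≈⟨ mult x≢0 x≢0 y₁≠0 y₂≠0 y₃≠0 ⟨
      ω (x ·F x) y₁ y₂ y₃           ≈⟨ resp x²≢0 one≠0 y₁≠0 y₂≠0 y₃≠0 x²≈1 ⟩
      ω oneF y₁ y₂ y₃               ≈⟨ ω-oneF ⟩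
      0ᴹ                            ∎)
      where
      x≢0 : NonZeroFrac x
      x≢0 = nonVanishing⇒nonZeroFrac x≠0
      x²≢0 : NonZeroFrac (x ·F x)
      x²≢0 = nonVanishing⇒nonZeroFrac (nonVanishing-·F x≠0 x≠0)

  -- In the first slot of ω, x acts as the product of the atoms a^(±1) for
  -- (±, a) in m; the sign by which they may differ is invisible to ω.
  record Expansion (x : Frac) (m : FormalSum Atom) : Set where
    field
      isNonVanishing : NonVanishingF x
      slot₁ : ∀ {y₁ y₂ y₃} → NonZeroFrac y₁ → NonZeroFrac y₂ → NonZeroFrac y₃ →
              ω x y₁ y₂ y₃ ≈ᴹ Σ± (λ a → ω (atom a) y₁ y₂ y₃) m

  open Expansion

  nonZero : ∀ {x m} → Expansion x m → NonZeroFrac x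
  nonZero = nonVanishing⇒nonZeroFrac ∘ isNonVanishing

  expansion-unit : ∀ {x} → NonVanishingF x → (x ·F x) ≈F oneF → Expansion x []
  expansion-unit x≠0 x²≈1 = record
    { isNonVanishing = x≠0
    ; slot₁ = λ y₁≠0 y₂≠0 y₃≠0 → ω-unit y₁≠0 y₂≠0 y₃≠0 x≠0 x²≈1
    }

  expansion-negOne : Expansion negOne []
  expansion-negOne = expansion-unit (nonVanishing (λ ()) //≢0 nonVanishing-one) λ _ → ≡.refl

  expansion-atom : ∀ {i j} → i ≢ j → Expansion (diff (var i) (var j)) [ (plus , (i , j)) ]
  expansion-atom {i} {j} i≢j = ≡.subst (λ x → Expansion x [ (plus , (i , j)) ]) (atom≡diff i≢j) (record
    { isNonVanishing = nonVanishing-atom (i , j)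
    ; slot₁ = λ _ _ _ → ≈ᴹ-sym (+ᴹ-identityʳ _)
    })

  expansion-≈ : ∀ {x y m} → x ≈F y → NonVanishing (den x) → Expansion y m → Expansion x m
  expansion-≈ {x} x≈y dx≠0 ey = record
    { isNonVanishing = x≠0
    ; slot₁ = λ y₁≠0 y₂≠0 y₃≠0 →
        ≈ᴹ-trans (resp (nonVanishing⇒nonZeroFrac x≠0) (nonZero ey) y₁≠0 y₂≠0 y₃≠0 x≈y) (slot₁ ey y₁≠0 y₂≠0 y₃≠0)
    }
    where
    x≠0 : NonVanishingF x
    x≠0 = nonVanishing-≈F {x} x≈y (isNonVanishing ey) dx≠0

  expansion-· : ∀ {x x′ m m′} → Expansion x m → Expansion x′ m′ → Expansion (x ·F x′) (m ++ m′)
  expansion-· {x} {x′} {m} {m′} ex ex′ = record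
    { isNonVanishing = nonVanishing-·F (isNonVanishing ex) (isNonVanishing ex′)
    ; slot₁ = λ {y₁} {y₂} {y₃} y₁≠0 y₂≠0 y₃≠0 → let e = λ a → ω (atom a) y₁ y₂ y₃ in begin
        ω (x ·F x′) y₁ y₂ y₃           ≈⟨ mult (nonZero ex) (nonZero ex′) y₁≠0 y₂≠0 y₃≠0 ⟩
        ω x y₁ y₂ y₃ +ᴹ ω x′ y₁ y₂ y₃  ≈⟨ +ᴹ-cong (slot₁ ex y₁≠0 y₂≠0 y₃≠0) (slot₁ ex′ y₁≠0 y₂≠0 y₃≠0) ⟩
        Σ± e m +ᴹ Σ± e m′              ≈⟨ Σ±-++ e m m′ ⟨
        Σ± e (m ++ m′)                 ∎
    }

  expansion-÷ : ∀ {x x′ m m′} → Expansion x m → Expansion x′ m′ → Expansion (x ÷F x′) (m ⊖ m′)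
  expansion-÷ {x@(n // d)} {x′@(n′ // d′)} {m} {m′} ex ex′ = record
    { isNonVanishing = q≠0
    ; slot₁ = λ {y₁} {y₂} {y₃} y₁≠0 y₂≠0 y₃≠0 → let e = λ a → ω (atom a) y₁ y₂ y₃ in begin
        ω (x ÷F x′) y₁ y₂ y₃              ≈⟨ x≈z//y _ _ _ (quotient-law y₁≠0 y₂≠0 y₃≠0) ⟩
        ω x y₁ y₂ y₃ +ᴹ -ᴹ ω x′ y₁ y₂ y₃  ≈⟨ +ᴹ-cong (slot₁ ex y₁≠0 y₂≠0 y₃≠0) (-ᴹ‿cong (slot₁ ex′ y₁≠0 y₂≠0 y₃≠0)) ⟩
        Σ± e m +ᴹ -ᴹ Σ± e m′              ≈⟨ Σ±-⊖ e m m′ ⟨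
        Σ± e (m ⊖ m′)                     ∎
    }
    where
    q≠0 : NonVanishingF (x ÷F x′)
    q≠0 = nonVanishing-÷F (isNonVanishing ex) (isNonVanishing ex′)
    quotient-law : ∀ {y₁ y₂ y₃} → NonZeroFrac y₁ → NonZeroFrac y₂ → NonZeroFrac y₃ →
                   ω (x ÷F x′) y₁ y₂ y₃ +ᴹ ω x′ y₁ y₂ y₃ ≈ᴹ ω x y₁ y₂ y₃
    quotient-law {y₁} {y₂} {y₃} y₁≠0 y₂≠0 y₃≠0 = begin
      ω (x ÷F x′) y₁ y₂ y₃ +ᴹ ω x′ y₁ y₂ y₃
        ≈⟨ mult (nonVanishing⇒nonZeroFrac q≠0) (nonZero ex′) y₁≠0 y₂≠0 y₃≠0 ⟨
      ω ((x ÷F x′) ·F x′) y₁ y₂ y₃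
        ≈⟨ resp (nonVanishing⇒nonZeroFrac (nonVanishing-·F q≠0 (isNonVanishing ex′))) (nonZero ex) y₁≠0 y₂≠0 y₃≠0
                (≈F-byRing (substitution n d n′ d′ d′) (((x₀ // x₁) ÷F (x₂ // x₃)) ·F (x₂ // x₃)) (x₀ // x₁)
                  λ _ → ≡.refl) ⟩
      ω x y₁ y₂ y₃
        ∎

  expansion-normalise : ∀ {x m} → Expansion x m → Expansion x (normaliseAtoms m)
  expansion-normalise {m = m} ex = record
    { isNonVanishing = isNonVanishing ex
    ; slot₁ = λ y₁≠0 y₂≠0 y₃≠0 → ≈ᴹ-trans (slot₁ ex y₁≠0 y₂≠0 y₃≠0) (≈ᴹ-sym (Σ±-normalise _≟ᵃ_ atomRank _ m))
    }

  expansion-difference : ∀ {i j} → i ≢ j → Expansion (diff (var i) (var j)) [ (plus , atomOf i j) ]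
  expansion-difference {i} {j} i≢j with i ≤?ᶠ j
  ... | yes _ = expansion-atom i≢j
  ... | no  _ = expansion-≈
    (≈F-byRing (substitution (var i) (var j) (var j) (var j) (var j)) (diff x₀ x₁) (negOne ·F diff x₁ x₀) λ _ → ≡.refl)
    nonVanishing-one
    (expansion-· expansion-negOne (expansion-atom (i≢j ∘ ≡.sym)))

  expansion-swap : ∀ {x y m} → Expansion (x −F y) m → Expansion (y −F x) m
  expansion-swap {n₁ // d₁} {n₂ // d₂} ex = expansion-≈
    (≈F-byRing (substitution n₁ d₁ n₂ d₂ d₂)
      ((x₂ // x₃) −F (x₀ // x₁)) (negOne ·F ((x₀ // x₁) −F (x₂ // x₃))) λ _ → ≡.refl)
    (nonVanishing-⊛-comm (den≢0 (isNonVanishing ex)))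
    (expansion-· expansion-negOne ex)

  ω-slot₂ : ∀ {x m y₁ y₂ y₃} → Expansion x m → NonZeroFrac y₁ → NonZeroFrac y₂ → NonZeroFrac y₃ →
            ω y₁ x y₂ y₃ ≈ᴹ Σ± (λ a → ω y₁ (atom a) y₂ y₃) m
  ω-slot₂ {x} {m} {y₁} {y₂} {y₃} ex y₁≠0 y₂≠0 y₃≠0 = begin
    ω y₁ x y₂ y₃                            ≈⟨ anti₁₂ y₁≠0 (nonZero ex) y₂≠0 y₃≠0 ⟩
    -ᴹ ω x y₁ y₂ y₃                         ≈⟨ -ᴹ‿cong (slot₁ ex y₁≠0 y₂≠0 y₃≠0) ⟩
    -ᴹ Σ± (λ a → ω (atom a) y₁ y₂ y₃) m     ≈⟨ Σ±-⁻¹ _ m ⟩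
    Σ± (λ a → -ᴹ ω (atom a) y₁ y₂ y₃) m     ≈⟨ Σ±-cong (λ a → ≈ᴹ-sym (anti₁₂ y₁≠0 (nonZero-atom a) y₂≠0 y₃≠0)) m ⟩
    Σ± (λ a → ω y₁ (atom a) y₂ y₃) m        ∎

  ω-slots₁₂ : ∀ {x₁ x₂ m₁ m₂ y₁ y₂} → Expansion x₁ m₁ → Expansion x₂ m₂ → NonZeroFrac y₁ → NonZeroFrac y₂ →
              ω x₁ x₂ y₁ y₂ ≈ᴹ Σ± (λ { (a , b) → ω (atom a) (atom b) y₁ y₂ }) (m₁ ∧ᵃ m₂)
  ω-slots₁₂ {x₁} {x₂} {m₁} {m₂} {y₁} {y₂} ex₁ ex₂ y₁≠0 y₂≠0 = begin
    ω x₁ x₂ y₁ y₂                          ≈⟨ slot₁ ex₁ (nonZero ex₂) y₁≠0 y₂≠0 ⟩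
    Σ± (λ a → ω (atom a) x₂ y₁ y₂) m₁      ≈⟨ Σ±-cong (λ a → ω-slot₂ ex₂ (nonZero-atom a) y₁≠0 y₂≠0) m₁ ⟩
    Σ± (λ a → Σ± (λ b → e (a , b)) m₂) m₁  ≈⟨ Σ±-wedge _≟ᵃ_ atomRank e e-diagonal e-antisymmetric 36 m₁ m₂ ⟨
    Σ± e (m₁ ∧ᵃ m₂)                        ∎
    where
    e : Pair → Carrierᴹ
    e (a , b) = ω (atom a) (atom b) y₁ y₂
    e-antisymmetric : ∀ a b → e (a , b) ≈ᴹ -ᴹ e (b , a)
    e-antisymmetric a b = anti₁₂ (nonZero-atom a) (nonZero-atom b) y₁≠0 y₂≠0
    e-diagonal : ∀ a → e (a , a) ≈ᴹ 0ᴹ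
    e-diagonal a = x≈-x⇒x≈0 W (e-antisymmetric a a)

  ω-slots₃₄ : ∀ {x₃ x₄ m₃ m₄ y₁ y₂} → Expansion x₃ m₃ → Expansion x₄ m₄ → NonZeroFrac y₁ → NonZeroFrac y₂ →
              ω y₁ y₂ x₃ x₄ ≈ᴹ Σ± (λ { (c , d) → ω y₁ y₂ (atom c) (atom d) }) (m₃ ∧ᵃ m₄)
  ω-slots₃₄ {x₃} {x₄} {m₃} {m₄} {y₁} {y₂} ex₃ ex₄ y₁≠0 y₂≠0 = begin
    ω y₁ y₂ x₃ x₄
      ≈⟨ antiPair y₁≠0 y₂≠0 (nonZero ex₃) (nonZero ex₄) ⟩
    -ᴹ ω x₃ x₄ y₁ y₂
      ≈⟨ -ᴹ‿cong (ω-slots₁₂ ex₃ ex₄ y₁≠0 y₂≠0) ⟩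
    -ᴹ Σ± (λ { (c , d) → ω (atom c) (atom d) y₁ y₂ }) (m₃ ∧ᵃ m₄)
      ≈⟨ Σ±-⁻¹ _ (m₃ ∧ᵃ m₄) ⟩
    Σ± (λ { (c , d) → -ᴹ ω (atom c) (atom d) y₁ y₂ }) (m₃ ∧ᵃ m₄)
      ≈⟨ Σ±-cong (λ { (c , d) → ≈ᴹ-sym (antiPair y₁≠0 y₂≠0 (nonZero-atom c) (nonZero-atom d)) }) (m₃ ∧ᵃ m₄) ⟩
    Σ± (λ { (c , d) → ω y₁ y₂ (atom c) (atom d) }) (m₃ ∧ᵃ m₄)
      ∎

  ω-expansion : ∀ {x₁ x₂ x₃ x₄ m₁ m₂ m₃ m₄} →
                Expansion x₁ m₁ → Expansion x₂ m₂ → Expansion x₃ m₃ → Expansion x₄ m₄ →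
                ω x₁ x₂ x₃ x₄ ≈ᴹ Σ± ωQuad ((m₁ ∧ᵃ m₂) ∧ᵖ (m₃ ∧ᵃ m₄))
  ω-expansion {x₁} {x₂} {x₃} {x₄} {m₁} {m₂} {m₃} {m₄} ex₁ ex₂ ex₃ ex₄ = begin
    ω x₁ x₂ x₃ x₄
      ≈⟨ ω-slots₁₂ ex₁ ex₂ (nonZero ex₃) (nonZero ex₄) ⟩
    Σ± (λ { (a , b) → ω (atom a) (atom b) x₃ x₄ }) (m₁ ∧ᵃ m₂)
      ≈⟨ Σ±-cong (λ { (a , b) → ω-slots₃₄ ex₃ ex₄ (nonZero-atom a) (nonZero-atom b) }) (m₁ ∧ᵃ m₂) ⟩
    Σ± (λ p → Σ± (λ q → ωQuad (p , q)) (m₃ ∧ᵃ m₄)) (m₁ ∧ᵃ m₂)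
      ≈⟨ Σ±-wedge _≟ᵖ_ pairRank ωQuad ωQuad-diagonal ωQuad-antisymmetric 1296 (m₁ ∧ᵃ m₂) (m₃ ∧ᵃ m₄) ⟨
    Σ± ωQuad ((m₁ ∧ᵃ m₂) ∧ᵖ (m₃ ∧ᵃ m₄))
      ∎
    where
    ωQuad-antisymmetric : ∀ p q → ωQuad (p , q) ≈ᴹ -ᴹ ωQuad (q , p)
    ωQuad-antisymmetric (a , b) (c , d) = antiPair (nonZero-atom a) (nonZero-atom b) (nonZero-atom c) (nonZero-atom d)
    ωQuad-diagonal : ∀ p → ωQuad (p , p) ≈ᴹ 0ᴹ
    ωQuad-diagonal p = x≈-x⇒x≈0 W (ωQuad-antisymmetric p p)

  module _ (π : Configuration) where

    private
      p : Fin 6 → Pol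
      p = point π

      distinct : ∀ {i j} → i ≢ j → π ⟨$⟩ʳ i ≢ π ⟨$⟩ʳ j
      distinct i≢j = i≢j ∘ Injection.injective (↔⇒↣ π)

      p≢p : ∀ {i j} → i ≢ j → NonVanishing (p i ⊝ p j)
      p≢p = nonVanishing-difference ∘ distinct

      expansion-p−p : ∀ {i j} → i ≢ j → Expansion (diff (p i) (p j)) (difference π i j)
      expansion-p−p = expansion-difference ∘ distinct

    expansion-cr−0 : ∀ k → Expansion (labelValue π (u k) −F zeroF) (crAtoms π k)
    expansion-cr−0 k = expansion-≈
      (≈F-byRing (substitution (p 0F) (p 1F) (p 2F) (p (uPoint k)) (p (uPoint k)))
        (cr x₀ x₁ x₂ x₃ −F zeroF) ((diff x₀ x₂ ·F diff x₁ x₃) ÷F (diff x₀ x₃ ·F diff x₁ x₂)) λ _ → ≡.refl)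
      (nonVanishing-⊛ (nonVanishing-⊛ (p≢p λ ()) (p≢p λ ())) nonVanishing-one)
      (expansion-÷ (expansion-· (expansion-p−p λ ()) (expansion-p−p λ ()))
                   (expansion-· (expansion-p−p λ ()) (expansion-p−p λ ())))

    expansion-1−cr : ∀ k → Expansion (oneF −F labelValue π (u k)) (oneMinusCrAtoms π k)
    expansion-1−cr k = expansion-≈
      (≈F-byRing (substitution (p 0F) (p 1F) (p 2F) (p (uPoint k)) (p (uPoint k)))
        (oneF −F cr x₀ x₁ x₂ x₃) ((diff x₀ x₁ ·F diff x₃ x₂) ÷F (diff x₀ x₃ ·F diff x₁ x₂)) λ _ → ≡.refl)
      (nonVanishing-⊛ nonVanishing-one (nonVanishing-⊛ (p≢p λ ()) (p≢p λ ())))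
      (expansion-÷ (expansion-· (expansion-p−p λ ()) (expansion-p−p λ ()))
                   (expansion-· (expansion-p−p λ ()) (expansion-p−p λ ())))

    expansion-cr−cr : ∀ {k l} → k ≢ l →
                      Expansion (labelValue π (u k) −F labelValue π (u l)) (crDifferenceAtoms π k l)
    expansion-cr−cr {k} {l} k≢l = expansion-≈
      (≈F-byRing (substitution (p 0F) (p 1F) (p 2F) (p (uPoint k)) (p (uPoint l)))
        (cr x₀ x₁ x₂ x₃ −F cr x₀ x₁ x₂ x₄)
        (((diff x₀ x₂ ·F diff x₀ x₁) ·F diff x₄ x₃) ÷F ((diff x₁ x₂ ·F diff x₀ x₃) ·F diff x₀ x₄)) λ _ → ≡.refl)
      (nonVanishing-⊛ (nonVanishing-⊛ (p≢p λ ()) (p≢p λ ())) (nonVanishing-⊛ (p≢p λ ()) (p≢p λ ())))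
      (expansion-÷ (expansion-· (expansion-· (expansion-p−p λ ()) (expansion-p−p λ ())) (expansion-p−p l≢k))
                   (expansion-· (expansion-· (expansion-p−p λ ()) (expansion-p−p λ ())) (expansion-p−p λ ())))
      where
      l≢k : uPoint l ≢ uPoint k
      l≢k = k≢l ∘ ≡.sym ∘ ↑ʳ-injective 3 l k

    expansion-factor : ∀ a b → Expansion (factor (labelValue π) a b) (factorAtoms π a b)
    expansion-factor z     z     = expansion-unit nonVanishing-oneF λ _ → ≡.refl
    expansion-factor o     o     = expansion-unit nonVanishing-oneF λ _ → ≡.refl
    expansion-factor z     o     = expansion-unit (nonVanishing (λ ()) //≢0 nonVanishing (λ ())) λ _ → ≡.refl
    expansion-factor o     z     = expansion-unit (nonVanishing (λ ()) //≢0 nonVanishing (λ ())) λ _ → ≡.refl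
    expansion-factor (u k) z     = expansion-cr−0 k
    expansion-factor z     (u k) = expansion-swap (expansion-cr−0 k)
    expansion-factor o     (u k) = expansion-1−cr k
    expansion-factor (u k) o     = expansion-swap (expansion-1−cr k)
    expansion-factor (u k) (u l) with k ≟ᶠ l
    ... | yes _   = expansion-unit nonVanishing-oneF λ _ → ≡.refl
    ... | no  k≢l = expansion-cr−cr k≢l

    expansion-entry : ∀ t → Expansion (entryAt (labelValue π) t) (entryAtoms π t)
    expansion-entry (a , next , prev) =
      expansion-normalise (expansion-÷ (expansion-factor a next) (expansion-factor a prev))

    ω-tensor : ∀ t → ωVec (Vec.map (entryAt (labelValue π)) t) ≈ᴹ Σ± ωQuad (tensorQuads π t)
    ω-tensor (t₁ ∷ t₂ ∷ t₃ ∷ t₄ ∷ []) =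
      ω-expansion (expansion-entry t₁) (expansion-entry t₂) (expansion-entry t₃) (expansion-entry t₄)

    ω-tensors : ∀ s ts → Σ± ωVec (signed s (List.map (Vec.map (entryAt (labelValue π))) ts))
                         ≈ᴹ sign s (Σ± ωQuad (concatMap (tensorQuads π) ts))
    ω-tensors s []       = ≈ᴹ-sym (sign-ε s)
    ω-tensors s (t ∷ ts) = begin
      sign s (ωVec (Vec.map (entryAt (labelValue π)) t))
        +ᴹ Σ± ωVec (signed s (List.map (Vec.map (entryAt (labelValue π))) ts))
        ≈⟨ +ᴹ-cong (sign-cong s (ω-tensor t)) (ω-tensors s ts) ⟩
      sign s (Σ± ωQuad (tensorQuads π t)) +ᴹ sign s (Σ± ωQuad (concatMap (tensorQuads π) ts))
        ≈⟨ sign-∙ s _ _ ⟨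
      sign s (Σ± ωQuad (tensorQuads π t) +ᴹ Σ± ωQuad (concatMap (tensorQuads π) ts))
        ≈⟨ sign-cong s (Σ±-++ ωQuad (tensorQuads π t) (concatMap (tensorQuads π) ts)) ⟨
      sign s (Σ± ωQuad (concatMap (tensorQuads π) (t ∷ ts)))
        ∎

    ω-S6 : ∀ s → Σ± ωVec (signed s (S6At π)) ≈ᴹ Σ± ωQuad (withSign s (i211Quads π))
    ω-S6 s = begin
      Σ± ωVec (signed s (S6At π))
        ≡⟨ ≡.cong (Σ± ωVec ∘ signed s) (S6≡skeleton π) ⟩
      Σ± ωVec (signed s (List.map (Vec.map (entryAt (labelValue π))) (skeleton 4 i211Points)))
        ≈⟨ ω-tensors s (skeleton 4 i211Points) ⟩
      sign s (Σ± ωQuad (i211Quads π))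
        ≈⟨ Σ±-withSign ωQuad s (i211Quads π) ⟨
      Σ± ωQuad (withSign s (i211Quads π))
        ∎

  Σ±-antisymmetrise : ∀ {K L} (e : K → Carrierᴹ) (e′ : L → Carrierᴹ) f g →
                      (∀ s π → Σ± e (f s π) ≈ᴹ Σ± e′ (g s π)) →
                      ∀ π → Σ± e (antisymmetrise f π) ≈ᴹ Σ± e′ (antisymmetrise g π)
  Σ±-antisymmetrise e e′ f g f≈g π =
    block plus π (block plus (cycle ∘ₚ π) (block plus (cycle² ∘ₚ π) (block minus (transpose 0F 1F ∘ₚ π)
      (block minus (transpose 1F 2F ∘ₚ π) (f≈g minus (transpose 0F 2F ∘ₚ π))))))
    where
    block : ∀ s σ {n n′} → Σ± e n ≈ᴹ Σ± e′ n′ → Σ± e (f s σ ++ n) ≈ᴹ Σ± e′ (g s σ ++ n′)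
    block s σ = Σ±-++-cong (f s σ) (g s σ) (f≈g s σ)

  evalComb≡Σ± : ∀ X → evalComb W ω X ≡ Σ± ωVec X
  evalComb≡Σ± []                                    = ≡.refl
  evalComb≡Σ± ((plus  , (x ∷ y ∷ z′ ∷ w ∷ [])) ∷ X) = ≡.cong (ω x y z′ w +ᴹ_) (evalComb≡Σ± X)
  evalComb≡Σ± ((minus , (x ∷ y ∷ z′ ∷ w ∷ [])) ∷ X) = ≡.cong (-ᴹ ω x y z′ w +ᴹ_) (evalComb≡Σ± X)

  evalComb-φ : ∀ π → evalComb W ω (φAt π) ≈ᴹ Σ± ωQuad (normaliseQuads (φQuads π))
  evalComb-φ π = begin
    evalComb W ω (φAt π)
      ≡⟨ evalComb≡Σ± (φAt π) ⟩
    Σ± ωVec (φAt π)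
      ≈⟨ Σ±-antisymmetrise ωVec ωQuad (λ s σ → signed s (S6At σ)) (λ s σ → withSign s (i211Quads σ))
                           (λ s σ → ω-S6 σ s) π ⟩
    Σ± ωQuad (φQuads π)
      ≈⟨ Σ±-normalise (≡-dec _≟ᵖ_ _≟ᵖ_) (lexRank 1296 pairRank) ωQuad (φQuads π) ⟨
    Σ± ωQuad (normaliseQuads (φQuads π))
      ∎

≐δ-byNormalForm : ∀ π ρ → normaliseQuads (φQuads π) ≡ normaliseQuads (φQuads ρ) → φAt π ≐δ φAt ρ
≐δ-byNormalForm π ρ same W ω adm = begin
  evalComb W ω (φAt π)                            ≈⟨ evalComb-φ W ω adm π ⟩
  Σ± (ωQuad W ω adm) (normaliseQuads (φQuads π))  ≡⟨ ≡.cong (Σ± (ωQuad W ω adm)) same ⟩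
  Σ± (ωQuad W ω adm) (normaliseQuads (φQuads ρ))  ≈⟨ evalComb-φ W ω adm ρ ⟨
  evalComb W ω (φAt ρ)                            ∎
  where
  open Module W using (≈ᴹ-setoid; +ᴹ-abelianGroup)
  open FormalSumEvaluation +ᴹ-abelianGroup using (Σ±)
  open SetoidReasoning ≈ᴹ-setoid

mainTheorem11 : (Sφ pa pb pc pd pe pf ≐δ Sφ pa pb pc pd pf pe)
                × (Sφ pa pb pc pd pf pe ≐δ Sφ pa pb pc pf pd pe)
mainTheorem11 = ≐δ-byNormalForm identity abcdfe ≡.refl , ≐δ-byNormalForm abcdfe abcfde ≡.refl
  where
  abcdfe abcfde : Configuration
  abcdfe = transpose 4F 5F
  abcfde = transpose 4F 5F ∘ₚ transpose 3F 5F
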